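{- Let $F$ be a CNF formula and run on $F$ the CDCL solver configured as below (VSIDS with decay factor $\delta \le 1/2$, fixed phase selection to false). Suppose the solver has learned at least one clause, and let $S$ be the set of variables occurring in the most recently learned clause. Then, whenever the solver makes a decision, it must branch on an unassigned variable of $S$ and assign it the value false, before it can branch on any variable not in $S$. In other words, as long as $S$ contains an unassigned variable, no variable outside $S$ is chosen as a decision variable.
   Context: CDCL solver configuration: the solver alternates unit propagation and decisions. When a clause becomes falsified (a conflict), it performs 1UIP conflict analysis and adds the resulting learned clause to a database of learned clauses (no clause is ever deleted). It then restarts after every conflict, i.e. backtracks to decision level 0. VSIDS branching heuristic: every variable $x$ has a score, initially $0$. After the $t$-th conflict the scores are updated by $q(x,t)=b(x,t)+\delta\, q(x,t-1)$, where $b(x,t)=1$ if $x$ occurs in the clause learned at conflict $t$ and $b(x,t)=0$ otherwise. The decay factor satisfies $0<\delta\le 1/2$. At each decision the solver picks an unassigned variable of highest score (ties broken by a fixed order) and assigns it the value false (fixed phase value selection).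
   Formalization: The VSIDS decay factor δ takes only rational values. -}

module Defs where

open import Data.Bool using (Bool; true; false)
open import Data.Fin using (Fin)
open import Data.Fin.Properties using (_≟_)
open import Data.Nat using (ℕ)
open import Data.List using (List; []; _∷_)
open import Data.List.Relation.Unary.Any using (Any; any?)
open import Data.Maybe using (Maybe; nothing; just)
open import Data.Product using (_×_; _,_; proj₁)
open import Data.Rational using (ℚ; 0ℚ; 1ℚ; _+_; _*_; _≤_)
open import Relation.Binary.PropositionalEquality using (_≡_)
open import Relation.Nullary using (yes; no)

-- A literal over variables Fin n: (variable , polarity); polarity true = positive.
Literal : ℕ → Set
Literal n = Fin n × Bool

Clause : ℕ → Set
Clause n = List (Literal n)

OccursIn : {n : ℕ} → Fin n → Clause n → Set
OccursIn x C = Any (λ l → proj₁ l ≡ x) C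

bump : {n : ℕ} → Fin n → Clause n → ℚ
bump x C with any? (λ l → proj₁ l ≟ x) C
... | yes _ = 1ℚ
... | no  _ = 0ℚ

-- VSIDS score after the sequence of conflicts whose learned clauses are
-- listed NEWEST FIRST:  q(x,0) = 0,  q(x,t) = b(x,t) + δ q(x,t-1).
score : {n : ℕ} → ℚ → List (Clause n) → Fin n → ℚ
score δ []       x = 0ℚ
score δ (C ∷ Cs) x = bump x C + δ * score δ Cs x

Assignment : ℕ → Set
Assignment n = Fin n → Maybe Bool

Unassigned : {n : ℕ} → Assignment n → Fin n → Set
Unassigned α x = α x ≡ nothing

record IsDecision {n : ℕ} (δ : ℚ) (hist : List (Clause n)) (ρ : Fin n → ℕ)
                  (α : Assignment n) (x : Fin n) (v : Bool) : Set where
  field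
    unassigned : Unassigned α x
    maximal    : ∀ y → Unassigned α y → score δ hist y ≤ score δ hist x
    tieBreak   : ∀ y → Unassigned α y → score δ hist y ≡ score δ hist x →
                 ρ x Data.Nat.≤ ρ y
    phase      : v ≡ false

{-# OPTIONS --safe #-}
-- With decay δ ≤ ½ a score is a sum Σ b(x,t) δ^(T-t) with 0/1 bumps, so it stays below
-- 1 + ½ + ¼ + … = 2, and the decayed history δ q(x,T-1) stays below 1. Hence after the
-- last conflict every variable of the learned clause scores at least 1 and every other
-- variable scores less than 1: the maximal-score decision must fall inside that clause.
module Submission where

open import Defs
open import Data.Bool using (Bool; false)
open import Data.Fin using (Fin)
open import Data.Fin.Properties using (_≟_)
open import Data.Nat using (ℕ)
open import Data.List using (List; []; _∷_)
open import Data.List.Relation.Unary.Any using (any?)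
open import Data.Product using (Σ; _×_; _,_; proj₁)
open import Data.Rational
  using (ℚ; 0ℚ; 1ℚ; ½; _<_; _≤_; _+_; _*_; NonNegative; nonNegative; positive)
open import Data.Rational.Properties
  using ( ≤-refl; <⇒≤; <-irrefl; <-≤-trans; positive⁻¹; pos⇒nonNeg
        ; +-mono-≤; +-monoʳ-≤; +-mono-≤-<; +-identityˡ; *-zeroʳ
        ; *-monoˡ-≤-nonNeg; *-monoʳ-≤-nonNeg; *-monoʳ-<-pos; module ≤-Reasoning )
open import Data.Empty using (⊥-elim)
open import Function.Definitions using (Injective)
open import Relation.Binary.PropositionalEquality using (_≡_; refl; cong)
open import Relation.Nullary using (yes; no; ¬_)

module _ {n : ℕ} (x : Fin n) (C : Clause n) where

  bump-occurs : OccursIn x C → bump x C ≡ 1ℚ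
  bump-occurs x∈C with any? (λ l → proj₁ l ≟ x) C
  ... | yes _   = refl
  ... | no  x∉C = ⊥-elim (x∉C x∈C)

  bump-¬occurs : ¬ OccursIn x C → bump x C ≡ 0ℚ
  bump-¬occurs x∉C with any? (λ l → proj₁ l ≟ x) C
  ... | yes x∈C = ⊥-elim (x∉C x∈C)
  ... | no  _   = refl

  bump-nonNeg : 0ℚ ≤ bump x C
  bump-nonNeg with any? (λ l → proj₁ l ≟ x) C
  ... | yes _ = <⇒≤ (positive⁻¹ 1ℚ)
  ... | no  _ = ≤-refl

  bump≤1 : bump x C ≤ 1ℚ
  bump≤1 with any? (λ l → proj₁ l ≟ x) C
  ... | yes _ = ≤-refl
  ... | no  _ = <⇒≤ (positive⁻¹ 1ℚ)

module _ {n : ℕ} (δ : ℚ) .{{_ : NonNegative δ}} where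
  open ≤-Reasoning

  mutual
    score-nonNeg : (Cs : List (Clause n)) (x : Fin n) → 0ℚ ≤ score δ Cs x
    score-nonNeg []       x = ≤-refl
    score-nonNeg (C ∷ Cs) x = +-mono-≤ (bump-nonNeg x C) (decayed-score-nonNeg Cs x)

    decayed-score-nonNeg : (Cs : List (Clause n)) (x : Fin n) → 0ℚ ≤ δ * score δ Cs x
    decayed-score-nonNeg Cs x = begin
      0ℚ               ≡⟨ *-zeroʳ δ ⟨
      δ * 0ℚ           ≤⟨ *-monoˡ-≤-nonNeg δ (score-nonNeg Cs x) ⟩
      δ * score δ Cs x ∎

  decayed-score<1 : δ ≤ ½ → (Cs : List (Clause n)) (x : Fin n) → δ * score δ Cs x < 1ℚ
  decayed-score<1 δ≤½ []       x = begin-strict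
    δ * 0ℚ ≡⟨ *-zeroʳ δ ⟩
    0ℚ     <⟨ positive⁻¹ 1ℚ ⟩
    1ℚ     ∎
  decayed-score<1 δ≤½ (C ∷ Cs) x = begin-strict
    δ * score δ (C ∷ Cs) x            ≤⟨ *-monoʳ-≤-nonNeg _ {{nonNegative (score-nonNeg (C ∷ Cs) x)}} δ≤½ ⟩
    ½ * (bump x C + δ * score δ Cs x) <⟨ *-monoʳ-<-pos ½ (+-mono-≤-< (bump≤1 x C) (decayed-score<1 δ≤½ Cs x)) ⟩
    ½ * (1ℚ + 1ℚ)                     ≡⟨⟩
    1ℚ                                ∎

  score-occurs≥1 : ∀ {x C} (Cs : List (Clause n)) → OccursIn x C → 1ℚ ≤ score δ (C ∷ Cs) x
  score-occurs≥1 {x} {C} Cs x∈C = begin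
    1ℚ + 0ℚ               ≤⟨ +-monoʳ-≤ 1ℚ (decayed-score-nonNeg Cs x) ⟩
    1ℚ + δ * score δ Cs x ≡⟨ cong (_+ δ * score δ Cs x) (bump-occurs x C x∈C) ⟨
    score δ (C ∷ Cs) x    ∎

  score-¬occurs<1 : δ ≤ ½ → ∀ {x C} (Cs : List (Clause n)) → ¬ OccursIn x C →
                    score δ (C ∷ Cs) x < 1ℚ
  score-¬occurs<1 δ≤½ {x} {C} Cs x∉C = begin-strict
    score δ (C ∷ Cs) x    ≡⟨ cong (_+ δ * score δ Cs x) (bump-¬occurs x C x∉C) ⟩
    0ℚ + δ * score δ Cs x ≡⟨ +-identityˡ _ ⟩
    δ * score δ Cs x      <⟨ decayed-score<1 δ≤½ Cs x ⟩
    1ℚ                    ∎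

  latest-clause-dominates : δ ≤ ½ → ∀ {x y C} (Cs : List (Clause n)) →
                            ¬ OccursIn x C → OccursIn y C →
                            score δ (C ∷ Cs) x < score δ (C ∷ Cs) y
  latest-clause-dominates δ≤½ Cs x∉C y∈C =
    <-≤-trans (score-¬occurs<1 δ≤½ Cs x∉C) (score-occurs≥1 Cs y∈C)

lemma1 : {n : ℕ} (δ : ℚ) → 0ℚ < δ → δ ≤ ½ →
         (C : Clause n) (older : List (Clause n)) →
         (ρ : Fin n → ℕ) → Injective _≡_ _≡_ ρ →
         (α : Assignment n) →
         Σ (Fin n) (λ y → OccursIn y C × Unassigned α y) →
         (x : Fin n) (v : Bool) → IsDecision δ (C ∷ older) ρ α x v →
         OccursIn x C × v ≡ false
lemma1 δ δ>0 δ≤½ C older _ _ _ (y , y∈C , y-unassigned) x _ decision =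
  x∈C , phase
  where
  open IsDecision decision
  instance δ≥0 : NonNegative δ
  δ≥0 = pos⇒nonNeg δ {{positive δ>0}}
  x∈C : OccursIn x C
  x∈C with any? (λ l → proj₁ l ≟ x) C
  ... | yes x∈C = x∈C
  ... | no  x∉C = ⊥-elim (<-irrefl refl
    (<-≤-trans (latest-clause-dominates δ δ≤½ older x∉C y∈C) (maximal y y-unassigned)))
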